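{- Let $(\mathcal R,\leq,r)$ be as in the context and let $\mathcal H\subseteq\mathcal R$ be a semiselective coideal. Then for every partition $f:\mathcal{AR}_2\to\{0,1\}$ and every $A\in\mathcal H$ there exists $B\in\mathcal H$ with $B\le A$ such that $f$ is constant on $\mathcal{AR}_2(B)$.
   Context: Setting: $\mathcal R$ is a set with a quasi-order $\leq$ and a map $r:\mathbb N\times\mathcal R\to\mathcal{AR}$ onto a set $\mathcal{AR}$; write $r_n(A)=r(n,A)$. Axiom A.1: $r_0(A)=\emptyset$; if $A\neq B$ then $r_n(A)\neq r_n(B)$ for some $n$; if $r_n(A)=r_m(B)$ then $n=m$ and $r_i(A)=r_i(B)$ for $i<n$. $|a|$ is the unique $n$ with $a=r_n(A)$ for some $A$; $\mathcal{AR}_n=\{a:|a|=n\}$; for $B\in\mathcal R$, $\mathcal{AR}_n(B)=\{r_n(C):C\in\mathcal R,\ C\le B\}$. Identifying $A$ with $(r_n(A))_n$, $\mathcal R$ is a closed subset of $\mathcal{AR}^{\mathbb N}$ ($\mathcal{AR}$ discrete, product topology). Notation: $[a,A]=\{B\in\mathcal R:\exists n\,(r_n(B)=a)\ \&\ B\leq A\}$; $[n,A]=[r_n(A),A]$; $\mathcal{AR}\restriction A=\{a:[a,A]\neq\emptyset\}$; $r_n[a,A]=\{r_n(B):B\in[a,A]\}$; $a\sqsubseteq b$ iff $a=r_m(A)$, $b=r_n(A)$ for some $A$ and $m\le n$. Axiom A.2: there is a quasi-order $\leq_{fin}$ on $\mathcal{AR}$ with $A\le B$ iff $\forall n\exists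 m\ r_n(A)\le_{fin} r_m(B)$; $\{b:b\le_{fin}a\}$ finite; if $a\le_{fin}b$, $c\sqsubseteq a$ then $c\le_{fin}d$ for some $d\sqsubseteq b$. $\operatorname{depth}_A(a)=\min\{n:a\le_{fin}r_n(A)\}$. Axiom A.3: if $\operatorname{depth}_A(a)=n$ then $[a,B]\ne\emptyset$ for all $B\in[n,A]$, and for all $B\in[a,A]$ there is $A'\in[n,A]$ with $[a,A']\subseteq[a,B]$. Axiom A.4: if $\operatorname{depth}_A(a)=n$ then for every $\mathcal O\subseteq\mathcal{AR}_{|a|+1}$ there is $B\in[n,A]$ with $r_{|a|+1}[a,B]\subseteq\mathcal O$ or $r_{|a|+1}[a,B]\cap\mathcal O=\emptyset$. Coideals: $\mathcal H\restriction A=\{B\in\mathcal H:B\le A\}$. $\mathcal H\subseteq\mathcal R$ is a coideal if (a) $A\in\mathcal H$, $A\le B$ imply $B\in\mathcal H$; (b) for all $A\in\mathcal H$, $a\in\mathcal{AR}\restriction A$: $[a,B]\neq\emptyset$ for all $B\in[\operatorname{depth}_A(a),A]\cap\mathcal H$, and if $B\in\mathcal H\restriction A$ with $[a,B]\ne\emptyset$ there is $A'\in[\operatorname{depth}_A(a),A]\cap\mathcal H$ with $\emptyset\ne[a,A']\subseteq[a,B]$; (c) for all $A\in\mathcal H$, $a\in\mathcal{AR}\restriction A$, $\mathcal O\subseteq\mathcal{AR}_{|a|+1}$ there is $B\in[\operatorname{depth}_A(a),A]\cap\mathcal H$ with $r_{|a|+1}[a,B]\subseteq\mathcal O$ or $r_{|a|+1}[a,B]\cap\mathcal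 O=\emptyset$. $\mathcal D\subseteq\mathcal S\subseteq\mathcal H$: $\mathcal D$ dense open in $\mathcal S$ if every $A\in\mathcal S$ has $B\in\mathcal D$, $B\le A$, and $A\in\mathcal S$, $B\in\mathcal D$, $A\le B$ imply $A\in\mathcal D$. $B$ diagonalizes $(A_a)_{a\in\mathcal{AR}\restriction A}$ if $[a,B]\subseteq[a,A_a]$ for all $a\in\mathcal{AR}\restriction B$; $B$ diagonalizes $(\mathcal D_a)_{a\in\mathcal{AR}\restriction A}$ (each $\mathcal D_a$ dense open in $\mathcal H\cap[\operatorname{depth}_A(a),A]$) if it diagonalizes some $(A_a)$ with $A_a\in\mathcal D_a$. $\mathcal H$ is semiselective if for every $A\in\mathcal H$, every such $(\mathcal D_a)$ and every $B\in\mathcal H\restriction A$ there is $C\in\mathcal H$, $C\le B$, diagonalizing $(\mathcal D_a)$. -}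

module Defs where

open import Level using (Level) renaming (suc to lsuc; zero to lzero)
open import Data.Nat using (ℕ; zero; suc; _<_; _≤_)
open import Data.Bool using (Bool)
open import Data.List using (List)
open import Data.List.Membership.Propositional using (_∈_)
open import Data.Product using (Σ; ∃; ∃-syntax; _×_; _,_)
open import Data.Sum using (_⊎_)
open import Relation.Nullary using (¬_)
open import Relation.Binary.PropositionalEquality using (_≡_; _≢_)

record RawSpace : Set₁ where
  field
    R     : Set
    AR    : Set
    _≤R_  : R → R → Set
    r     : ℕ → R → AR
    _≤fin_ : AR → AR → Set
    ∅AR   : AR

module Notions (S : RawSpace) where
  open RawSpace S

  -- a ∈ AR_n   (i.e. |a| = n; unique by A.1)
  InAR : ℕ → AR → Set
  InAR n a = ∃[ A ] r n A ≡ a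

  InARof : ℕ → R → AR → Set
  InARof n B a = ∃[ C ] (C ≤R B × r n C ≡ a)

  InInt : AR → R → R → Set
  InInt a A B = (∃[ n ] r n B ≡ a) × B ≤R A

  InIntN : ℕ → R → R → Set
  InIntN n A B = InInt (r n A) A B

  InARr : R → AR → Set
  InARr A a = ∃[ B ] InInt a A B

  IntSub : AR → R → R → Set
  IntSub a A B = ∀ C → InInt a A C → InInt a B C

  _⊑_ : AR → AR → Set
  a ⊑ b = ∃[ A ] ∃[ m ] ∃[ n ] (m ≤ n × r m A ≡ a × r n A ≡ b)

  Depth : R → AR → ℕ → Set
  Depth A a n = (a ≤fin r n A) × (∀ m → m < n → ¬ (a ≤fin r m A))

  Homog : ℕ → AR → R → (AR → Set) → Set
  Homog k a B O =
    (∀ C → InInt a B C → O (r (suc k) C)) ⊎ (∀ C → InInt a B C → ¬ O (r (suc k) C))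

  IsQuasiOrder : {X : Set} → (X → X → Set) → Set
  IsQuasiOrder _≼_ = (∀ x → x ≼ x) × (∀ x y z → x ≼ y → y ≼ z → x ≼ z)

  record Axioms : Set₁ where
    field
      ≤R-quasi   : IsQuasiOrder _≤R_
      r-onto     : ∀ a → ∃[ n ] ∃[ A ] r n A ≡ a
      A1-empty   : ∀ A → r 0 A ≡ ∅AR
      A1-sep     : ∀ A B → A ≢ B → ∃[ n ] r n A ≢ r n B
      A1-len     : ∀ n m A B → r n A ≡ r m B →
                   n ≡ m × (∀ i → i < n → r i A ≡ r i B)
      -- closedness of R in AR^ℕ (AR discrete, product topology)
      closed     : ∀ (s : ℕ → AR) →
                   (∀ n → ∃[ A ] (∀ i → i < n → r i A ≡ s i)) →
                   ∃[ A ] (∀ n → r n A ≡ s n)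
      ≤fin-quasi : IsQuasiOrder _≤fin_
      A2-≤       : ∀ A B → (A ≤R B → ∀ n → ∃[ m ] r n A ≤fin r m B)
                         × ((∀ n → ∃[ m ] r n A ≤fin r m B) → A ≤R B)
      A2-finite  : ∀ a → ∃[ l ] (∀ b → b ≤fin a → b ∈ l)
      A2-sub     : ∀ a b c → a ≤fin b → c ⊑ a → ∃[ d ] (d ⊑ b × c ≤fin d)
      A3-a       : ∀ A a n → Depth A a n → ∀ B → InIntN n A B → InARr B a
      A3-b       : ∀ A a n → Depth A a n → ∀ B → InInt a A B →
                   ∃[ A' ] (InIntN n A A' × IntSub a A' B)
      A4         : ∀ A a n k → Depth A a n → InAR k a →
                   ∀ (O : AR → Set) → (∀ b → O b → InAR (suc k) b) →
                   ∃[ B ] (InIntN n A B × Homog k a B O)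

  record IsCoideal (H : R → Set) : Set₁ where
    field
      up  : ∀ A B → H A → A ≤R B → H B
      b₁  : ∀ A a n → H A → InARr A a → Depth A a n →
            ∀ B → InIntN n A B → H B → InARr B a
      b₂  : ∀ A a n → H A → InARr A a → Depth A a n →
            ∀ B → H B → B ≤R A → InARr B a →
            ∃[ A' ] (InIntN n A A' × H A' × InARr A' a × IntSub a A' B)
      c   : ∀ A a n k → H A → InARr A a → Depth A a n → InAR k a →
            ∀ (O : AR → Set) → (∀ b → O b → InAR (suc k) b) →
            ∃[ B ] (InIntN n A B × H B × Homog k a B O)

  DenseOpen : (R → Set) → (R → Set) → Set
  DenseOpen Sp D =
    (∀ A → D A → Sp A)
    × (∀ A → Sp A → ∃[ B ] (D B × B ≤R A))
    × (∀ A B → Sp A → D B → A ≤R B → D A)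

  Diagonalizes : R → (AR → R) → Set
  Diagonalizes B Af = ∀ a → InARr B a → IntSub a B (Af a)

  DiagonalizesD : R → (AR → R → Set) → R → Set
  DiagonalizesD A D B =
    ∃[ Af ] ((∀ a → InARr A a → D a (Af a)) × Diagonalizes B Af)

  Semiselective : (R → Set) → Set₁
  Semiselective H =
    ∀ A → H A → ∀ (D : AR → R → Set) →
      (∀ a n → InARr A a → Depth A a n →
         DenseOpen (λ X → H X × InIntN n A X) (D a)) →
      ∀ B → H B → B ≤R A →
      ∃[ C ] (H C × C ≤R B × DiagonalizesD A D C)

  ARof⇒AR : ∀ {n B a} → InARof n B a → InAR n a
  ARof⇒AR (C , _ , eq) = C , eq

  ConstantOnAR2 : ((a : AR) → .(InAR 2 a) → Bool) → R → Set
  ConstantOnAR2 f B = ∃[ i ] (∀ a → (p : InARof 2 B a) → f a (ARof⇒AR p) ≡ i)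

module Submission where

-- For each a, the C′ ∈ H ∩ [depth_A a, A] on which the one-step extensions
-- r_{|a|+1}[a, C′] are monochromatic form a dense open set, by coideal axiom (c).
-- Diagonalizing them gives C ≤ A in H that is monochromatic above every
-- a ∈ AR↾C. Then f induces a colouring of AR₁(C), a ↦ colour of r₂[a, C], and
-- one more application of (c) at the empty approximation makes it constant
-- below some B ≤ C.

open import Defs
open import Data.Bool using (Bool; true; false)
open import Data.Bool.Properties using (¬-not)
open import Data.Empty using (⊥-elim)
open import Data.Nat using (ℕ; suc; _≤_)
open import Data.Nat.Properties using (≤-refl; <⇒≤; <-cmp; m≤n⇒m<n∨m≡n)
open import Data.Product using (Σ; ∃-syntax; _×_; _,_; proj₁; proj₂)
open import Data.Sum using (_⊎_; inj₁; inj₂)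
open import Relation.Binary.Definitions using (tri<; tri≈; tri>)
open import Relation.Binary.PropositionalEquality using (_≡_; refl; sym; trans; subst)
open import Relation.Nullary using (¬_)

module Approximations (S : RawSpace) (ax : Notions.Axioms S) where
  open RawSpace S
  open Notions S
  open Axioms ax

  ≤R-refl : ∀ X → X ≤R X
  ≤R-refl = proj₁ ≤R-quasi

  ≤R-trans : ∀ {X Y Z} → X ≤R Y → Y ≤R Z → X ≤R Z
  ≤R-trans {X} {Y} {Z} = proj₂ ≤R-quasi X Y Z

  InAR-unique : ∀ {k k′ a} → InAR k a → InAR k′ a → k ≡ k′
  InAR-unique (C , eq) (C′ , eq′) = proj₁ (A1-len _ _ C C′ (trans eq (sym eq′)))

  Depth-unique : ∀ {X a n n′} → Depth X a n → Depth X a n′ → n ≡ n′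
  Depth-unique {n = n} {n′} (a≤n , min) (a≤n′ , min′) with <-cmp n n′
  ... | tri< n<n′ _ _ = ⊥-elim (min′ n n<n′ a≤n)
  ... | tri≈ _ n≡n′ _ = n≡n′
  ... | tri> _ _ n′<n = ⊥-elim (min n′ n′<n a≤n′)

  Depth-r₀ : ∀ X → Depth X (r 0 X) 0
  Depth-r₀ X = proj₁ ≤fin-quasi (r 0 X) , λ _ ()

  InInt-self : ∀ n {E X} → E ≤R X → InInt (r n E) X E
  InInt-self n E≤X = (n , refl) , E≤X

  InInt-r₀ : ∀ Y {E X} → E ≤R X → InInt (r 0 Y) X E
  InInt-r₀ Y {E} E≤X = (0 , trans (A1-empty E) (sym (A1-empty Y))) , E≤X

  InIntN⇒prefix : ∀ {n A X} → InIntN n A X → ∀ i → i ≤ n → r i X ≡ r i A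
  InIntN⇒prefix ((m , eq) , _) i i≤n with A1-len m _ _ _ eq
  ... | refl , agree with m≤n⇒m<n∨m≡n i≤n
  ...   | inj₁ i<n = agree i i<n
  ...   | inj₂ refl = eq

  InIntN-trans : ∀ {n A X Y} → InIntN n A X → InIntN n X Y → InIntN n A Y
  InIntN-trans {n} X∈ ((m , eq) , Y≤X) =
    (m , trans eq (InIntN⇒prefix X∈ n ≤-refl)) , ≤R-trans Y≤X (proj₂ X∈)

  Depth-InIntN : ∀ {n A X a} → Depth A a n → InIntN n A X → Depth X a n
  Depth-InIntN {n} (a≤rₙ , min) X∈ =
    subst (_ ≤fin_) (sym (InIntN⇒prefix X∈ n ≤-refl)) a≤rₙ ,
    λ i i<n a≤rᵢ → min i i<n (subst (_ ≤fin_) (InIntN⇒prefix X∈ i (<⇒≤ i<n)) a≤rᵢ)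

  IntSub-≤R : ∀ {a X Y} → X ≤R Y → IntSub a X Y
  IntSub-≤R X≤Y _ (len , E≤X) = len , ≤R-trans E≤X X≤Y

  Homog-antitone : ∀ {k a X Y O} → IntSub a X Y → Homog k a Y O → Homog k a X O
  Homog-antitone sub (inj₁ all) = inj₁ λ E E∈ → all E (sub E E∈)
  Homog-antitone sub (inj₂ none) = inj₂ λ E E∈ → none E (sub E E∈)

module Ramsey (S : RawSpace) (ax : Notions.Axioms S)
  (H : RawSpace.R S → Set) (co : Notions.IsCoideal S H) (ss : Notions.Semiselective S H) where
  open RawSpace S
  open Notions S
  open Axioms ax
  open IsCoideal co
  open Approximations S ax

  module _ (Col : ℕ → AR → Set) (Col⊆AR : ∀ k b → Col k b → InAR (suc k) b) where

    HomogeneousAt : R → AR → R → Set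
    HomogeneousAt A a X =
      H X × (∀ n → Depth A a n → InIntN n A X) × (∀ k → InAR k a → Homog k a X (Col k))

    HomogeneousAt-denseOpen : ∀ A → H A → ∀ a n → InARr A a → Depth A a n →
      DenseOpen (λ X → H X × InIntN n A X) (HomogeneousAt A a)
    HomogeneousAt-denseOpen A HA a n a∈A@(_ , (k , a≡) , _) depth = included , dense , open′
      where
      InIntN-depth : ∀ {X} → InIntN n A X → ∀ n′ → Depth A a n′ → InIntN n′ A X
      InIntN-depth X∈ n′ depth′ with Depth-unique depth depth′
      ... | refl = X∈

      included : ∀ X → HomogeneousAt A a X → H X × InIntN n A X
      included X (HX , X∈ , _) = HX , X∈ n depth

      dense : ∀ X → H X × InIntN n A X → ∃[ Y ] (HomogeneousAt A a Y × Y ≤R X)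
      dense X (HX , X∈) with c X a n k HX (b₁ A a n HA a∈A depth X X∈ HX)
                                (Depth-InIntN depth X∈) (_ , a≡) (Col k) (Col⊆AR k)
      ... | Y , Y∈ , HY , homog =
            Y , (HY , InIntN-depth (InIntN-trans X∈ Y∈) , homogeneous) , proj₂ Y∈
        where
        homogeneous : ∀ k′ → InAR k′ a → Homog k′ a Y (Col k′)
        homogeneous k′ a∈AR with InAR-unique (_ , a≡) a∈AR
        ... | refl = homog

      open′ : ∀ X Y → H X × InIntN n A X → HomogeneousAt A a Y → X ≤R Y →
              HomogeneousAt A a X
      open′ X Y (HX , X∈) (_ , _ , homog) X≤Y =
        HX , InIntN-depth X∈ ,
        λ k a∈AR → Homog-antitone {O = Col k} (IntSub-≤R X≤Y) (homog k a∈AR)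

    homogenize : ∀ A → H A →
      ∃[ C ] (H C × C ≤R A × (∀ a k → InARr C a → InAR k a → Homog k a C (Col k)))
    homogenize A HA
      with ss A HA (HomogeneousAt A) (HomogeneousAt-denseOpen A HA) A HA (≤R-refl A)
    ... | C , HC , C≤A , Aₐ , Aₐ-homog , diag = C , HC , C≤A , homogeneous
      where
      homogeneous : ∀ a k → InARr C a → InAR k a → Homog k a C (Col k)
      homogeneous a k a∈C@(E , E∈) a∈AR =
        Homog-antitone {O = Col k} (diag a a∈C)
          (proj₂ (proj₂ (Aₐ-homog a (E , IntSub-≤R C≤A E E∈))) k a∈AR)

  module _ (P : AR → Set) where

    ColourAR₁ : R → AR → Set
    ColourAR₁ C a = InAR 1 a × (∀ E → InInt a C E → P (r 2 E))

    Homog₁ : R → AR → Set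
    Homog₁ C a = Homog 1 a C (λ b → InAR 2 b × P b)

    AR₂-decided : ∀ {B C} → B ≤R C → (∀ E → E ≤R C → Homog₁ C (r 1 E)) →
      Homog 0 (r 0 C) B (ColourAR₁ C) →
      (∀ E → E ≤R B → P (r 2 E)) ⊎ (∀ E → E ≤R B → ¬ P (r 2 E))
    AR₂-decided {B} {C} B≤C homogC (inj₁ all) = inj₁ λ E E≤B →
      proj₂ (all E (InInt-r₀ C E≤B)) E (InInt-self 1 (≤R-trans E≤B B≤C))
    AR₂-decided {B} {C} B≤C homogC (inj₂ none) = inj₂ λ E E≤B →
      by-cases E E≤B (homogC E (≤R-trans E≤B B≤C))
      where
      by-cases : ∀ E → E ≤R B → Homog₁ C (r 1 E) → ¬ P (r 2 E)
      by-cases E E≤B (inj₁ all) _ =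
        none E (InInt-r₀ C E≤B) ((E , refl) , λ E′ E′∈ → proj₂ (all E′ E′∈))
      by-cases E E≤B (inj₂ none′) p =
        none′ E (InInt-self 1 (≤R-trans E≤B B≤C)) ((E , refl) , p)

    AR₂-homogenize : ∀ A → H A →
      ∃[ B ] (H B × B ≤R A ×
              ((∀ E → E ≤R B → P (r 2 E)) ⊎ (∀ E → E ≤R B → ¬ P (r 2 E))))
    AR₂-homogenize A HA
      with homogenize (λ k b → InAR (suc k) b × P b) (λ _ _ → proj₁) A HA
    ... | C , HC , C≤A , homogC
      with c C (r 0 C) 0 0 HC (C , InInt-self 0 (≤R-refl C)) (Depth-r₀ C) (C , refl)
             (ColourAR₁ C) (λ _ → proj₁)
    ... | B , (_ , B≤C) , HB , homogB =
      B , HB , ≤R-trans B≤C C≤A ,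
      AR₂-decided B≤C (λ E E≤C → homogC (r 1 E) 1 (E , InInt-self 1 E≤C) (E , refl)) homogB

open RawSpace
open Notions

module _ (S : RawSpace) (f : (a : AR S) → .(InAR S 2 a) → Bool) where

  Red : AR S → Set
  Red b = Σ (InAR S 2 b) λ p → f b p ≡ true

  ConstantOnAR2-decided : ∀ B →
    (∀ E → _≤R_ S E B → Red (r S 2 E)) ⊎ (∀ E → _≤R_ S E B → ¬ Red (r S 2 E)) →
    ConstantOnAR2 S f B
  ConstantOnAR2-decided B (inj₁ red) =
    true , λ { _ (E , E≤B , refl) → proj₂ (red E E≤B) }
  ConstantOnAR2-decided B (inj₂ notRed) =
    false , λ { _ (E , E≤B , refl) → ¬-not λ red → notRed E E≤B ((E , refl) , red) }

theorem3p17 : (S : RawSpace) → Axioms S →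
    (H : R S → Set) → IsCoideal S H → Semiselective S H →
    (f : (a : AR S) → .(InAR S 2 a) → Bool) →
    ∀ A → H A →
    ∃[ B ] (H B × _≤R_ S B A × ConstantOnAR2 S f B)
theorem3p17 S ax H co ss f A HA
  with Ramsey.AR₂-homogenize S ax H co ss (Red S f) A HA
... | B , HB , B≤A , decided = B , HB , B≤A , ConstantOnAR2-decided S f B decided
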